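{- Let $G=(V,E)$ be a finite simple graph having a solution to the Edge-Vertex Problem, let $S$ be an optimal solution to the Minimum Edge-Vertex Problem for $G$, and let $G'=(V,S)$ be the spanning subgraph of $G$ with edge set $S$. Then $G'$ contains no cycle. Moreover, for each connected component $H$ of $G'$, the subgraph of $G$ induced by the vertex set $V(H)$ is a tree (namely $H$ itself).
   Context: For a graph $G=(V,E)$, a solution to the Edge-Vertex Problem is a subset $X\subseteq E$ such that for every vertex $v\in V$ the number of edges of $X$ incident with $v$ is odd. An optimal solution to the Minimum Edge-Vertex Problem is a solution of minimum cardinality. -}

module Defs where

open import Data.Nat using (ℕ; zero; suc; _+_; _≤_; _<ᵇ_; _%_)
open import Data.Fin using (Fin; toℕ)
import Data.Fin as F
open import Data.Bool using (Bool; true; false; if_then_else_; _∧_)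
open import Data.List using (List; []; _∷_; _++_; [_]; length)
open import Data.List.Relation.Unary.All using (All)
open import Data.List.Relation.Unary.Linked using (Linked)
open import Data.List.Relation.Unary.Unique.Propositional using (Unique)
open import Data.Product using (Σ; ∃; _×_; _,_)
open import Data.Unit using (⊤)
open import Relation.Nullary using (¬_)
open import Relation.Binary.PropositionalEquality using (_≡_)

-- An edge relation on the vertex set Fin n, as a Boolean adjacency matrix.
-- The undirected edge {u,v} is present iff E u v ≡ true.
EdgeRel : ℕ → Set
EdgeRel n = Fin n → Fin n → Bool

record SimpleGraph (n : ℕ) : Set where
  field
    Adj    : EdgeRel n
    sym    : ∀ u v → Adj u v ≡ Adj v u
    irrefl : ∀ v → Adj v v ≡ false
open SimpleGraph public

count : ∀ {n} → (Fin n → Bool) → ℕ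
count {zero}  p = 0
count {suc n} p = (if p F.zero then 1 else 0) + count (λ i → p (F.suc i))

sumFin : ∀ {n} → (Fin n → ℕ) → ℕ
sumFin {zero}  f = 0
sumFin {suc n} f = f F.zero + sumFin (λ i → f (F.suc i))

IsEdgeSubset : ∀ {n} → SimpleGraph n → EdgeRel n → Set
IsEdgeSubset G X = (∀ u v → X u v ≡ X v u) × (∀ u v → X u v ≡ true → Adj G u v ≡ true)

degree : ∀ {n} → EdgeRel n → Fin n → ℕ
degree X v = count (X v)

edgeCount : ∀ {n} → EdgeRel n → ℕ
edgeCount X = sumFin (λ u → count (λ v → (toℕ u <ᵇ toℕ v) ∧ X u v))

IsSolution : ∀ {n} → SimpleGraph n → EdgeRel n → Set
IsSolution G X = IsEdgeSubset G X × (∀ v → degree X v % 2 ≡ 1)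

HasSolution : ∀ {n} → SimpleGraph n → Set
HasSolution G = Σ _ (IsSolution G)

IsOptimalSolution : ∀ {n} → SimpleGraph n → EdgeRel n → Set
IsOptimalSolution G S = IsSolution G S × (∀ X → IsSolution G X → edgeCount S ≤ edgeCount X)

data Walk {n} (E : EdgeRel n) (P : Fin n → Set) : Fin n → Fin n → Set where
  here : ∀ {v} → P v → Walk E P v v
  step : ∀ {u v w} → P u → E u v ≡ true → Walk E P v w → Walk E P u w

Cycle : ∀ {n} → EdgeRel n → (Fin n → Set) → Set
Cycle {n} E P =
  Σ (Fin n) λ v → Σ (List (Fin n)) λ ws →
    3 ≤ length (v ∷ ws) × Unique (v ∷ ws) × All P (v ∷ ws) ×
    Linked (λ a b → E a b ≡ true) (v ∷ ws ++ [ v ])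

Connected : ∀ {n} → EdgeRel n → (Fin n → Set) → Set
Connected E P = ∀ u v → P u → P v → Walk E P u v

IsTree : ∀ {n} → EdgeRel n → (Fin n → Set) → Set
IsTree {n} E P = (Σ (Fin n) P) × Connected E P × ¬ Cycle E P

Component : ∀ {n} → EdgeRel n → Fin n → Fin n → Set
Component S w v = Walk S (λ _ → ⊤) w v

module Submission where

-- If an optimal solution S contained a path u = x₀, …, x_k = v with k ≥ 2 whose ends are adjacent
-- in G, toggling its k edges together with the edge vu would change every degree by an even amount
-- and give a solution with at most |S| − k + 1 < |S| edges. A cycle of S is such a path closed by
-- an edge of S ⊆ G. And an edge uv of G inside a component of S lies in S: the S-path from u to v
-- has length ≥ 1 as G has no loops, and not ≥ 2 by the above.

open import Defs hiding (sym)
open import Data.Bool using (Bool; true; false; not; _∧_; _xor_; if_then_else_)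
open import Data.Bool.Properties using (⇔→≡)
open import Data.Fin using (Fin; _≟_; _<?_)
import Data.Fin as Fin
open import Data.Fin.Properties using (<-cmp; <-asym; suc-injective)
open import Data.List using (List; []; _∷_; _++_; [_]; length)
open import Data.List.Membership.Propositional using (_∈_)
import Data.List.Membership.DecPropositional as DecMembership
open import Data.List.Relation.Unary.All as All using (All; []; _∷_)
open import Data.List.Relation.Unary.All.Properties using (¬Any⇒All¬; ∷ʳ⁺)
open import Data.List.Relation.Unary.AllPairs using ([]; _∷_)
open import Data.List.Relation.Unary.Any using (here; there)
open import Data.List.Relation.Unary.Linked using (Linked; []; [-]; _∷_)
open import Data.List.Relation.Unary.Unique.Propositional using (Unique)
open import Data.Nat using (ℕ; zero; suc; _+_; _≤_; _<_; _%_; s≤s; z≤n; parity)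
open import Data.Nat.Properties using (+-comm; +-suc; +-identityʳ; +-monoʳ-≤; <⇒≱; <⇒≤; n<1+n; ≤-reflexive; m≤n⇒m≤1+n; module ≤-Reasoning)
open import Data.Parity using (Parity; 0ℙ; 1ℙ) renaming (_+_ to _⊕_)
open import Data.Parity.Properties using (+-homo-+; p+p≡0ℙ) renaming (+-comm to ⊕-comm; +-assoc to ⊕-assoc; +-identityʳ to ⊕-identityʳ)
open import Data.Product using (Σ-syntax; _×_; _,_; proj₁; proj₂; swap)
import Data.Product as Product
open import Data.Sum using (_⊎_; inj₁; inj₂)
import Data.Sum as Sum
open import Data.Unit using (⊤; tt)
open import Function using (_∘_; mk⇔)
open import Relation.Binary using (tri<; tri≈; tri>)
open import Relation.Binary.PropositionalEquality using (_≡_; _≢_; refl; sym; trans; cong; cong₂; ≢-sym; module ≡-Reasoning)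
open import Relation.Nullary using (¬_; Dec; yes; no; does; contradiction)
open import Relation.Nullary.Decidable using (dec-true; dec-false; _×-dec_; _⊎-dec_)

private
  variable
    n : ℕ

indicator : Bool → ℕ
indicator b = if b then 1 else 0

count≡sumFin : (p : Fin n → Bool) → count p ≡ sumFin (indicator ∘ p)
count≡sumFin {zero}  p = refl
count≡sumFin {suc n} p = cong (indicator (p Fin.zero) +_) (count≡sumFin (p ∘ Fin.suc))

sumFin-cong : {f g : Fin n → ℕ} → (∀ i → f i ≡ g i) → sumFin f ≡ sumFin g
sumFin-cong {zero}  f≗g = refl
sumFin-cong {suc n} f≗g = cong₂ _+_ (f≗g Fin.zero) (sumFin-cong (f≗g ∘ Fin.suc))

sumFin-suc-at : {f g : Fin n → ℕ} (i : Fin n) → (∀ j → j ≢ i → f j ≡ g j) → suc (f i) ≡ g i →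
  suc (sumFin f) ≡ sumFin g
sumFin-suc-at {suc n} {f} {g} Fin.zero agree fᵢ<gᵢ =
  cong₂ _+_ fᵢ<gᵢ (sumFin-cong (λ j → agree (Fin.suc j) λ ()))
sumFin-suc-at {suc n} {f} {g} (Fin.suc i) agree fᵢ<gᵢ = begin
  suc (f Fin.zero + sumFin (f ∘ Fin.suc))  ≡⟨ sym (+-suc (f Fin.zero) _) ⟩
  f Fin.zero + suc (sumFin (f ∘ Fin.suc))  ≡⟨ cong₂ _+_ (agree Fin.zero λ ())
                                                 (sumFin-suc-at i (λ j j≢i → agree (Fin.suc j) (j≢i ∘ suc-injective)) fᵢ<gᵢ) ⟩
  g Fin.zero + sumFin (g ∘ Fin.suc)        ∎
  where open ≡-Reasoning

count-cong : {p q : Fin n → Bool} → (∀ i → p i ≡ q i) → count p ≡ count q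
count-cong {p = p} {q} p≗q =
  trans (count≡sumFin p) (trans (sumFin-cong (cong indicator ∘ p≗q)) (sym (count≡sumFin q)))

count-suc-at : {p q : Fin n → Bool} (i : Fin n) → (∀ j → j ≢ i → p j ≡ q j) →
  p i ≡ false → q i ≡ true → suc (count p) ≡ count q
count-suc-at {p = p} {q} i agree pᵢ qᵢ = begin
  suc (count p)                  ≡⟨ cong suc (count≡sumFin p) ⟩
  suc (sumFin (indicator ∘ p))   ≡⟨ sumFin-suc-at i (λ j j≢i → cong indicator (agree j j≢i))
                                      (trans (cong (suc ∘ indicator) pᵢ) (cong indicator (sym qᵢ))) ⟩
  sumFin (indicator ∘ q)         ≡⟨ sym (count≡sumFin q) ⟩
  count q                        ∎
  where open ≡-Reasoning

p⊕q⊕q≡p : ∀ p q → p ⊕ q ⊕ q ≡ p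
p⊕q⊕q≡p p q = trans (⊕-assoc p q q) (trans (cong (p ⊕_) (p+p≡0ℙ q)) (⊕-identityʳ p))

parity-suc : ∀ m → parity (suc m) ≡ parity m ⊕ 1ℙ
parity-suc m = trans (+-homo-+ 1 m) (⊕-comm 1ℙ (parity m))

%2≡1⇒parity≡1ℙ : ∀ m → m % 2 ≡ 1 → parity m ≡ 1ℙ
%2≡1⇒parity≡1ℙ (suc zero)    _ = refl
%2≡1⇒parity≡1ℙ (suc (suc m)) h = %2≡1⇒parity≡1ℙ m h

parity≡1ℙ⇒%2≡1 : ∀ m → parity m ≡ 1ℙ → m % 2 ≡ 1
parity≡1ℙ⇒%2≡1 (suc zero)    _ = refl
parity≡1ℙ⇒%2≡1 (suc (suc m)) h = parity≡1ℙ⇒%2≡1 m h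

count-parity-flip : {p q : Fin n → Bool} (i : Fin n) → (∀ j → j ≢ i → p j ≡ q j) →
  q i ≡ not (p i) → parity (count q) ≡ parity (count p) ⊕ 1ℙ
count-parity-flip {p = p} {q} i agree qᵢ with p i in pᵢ
... | false = trans (cong parity (sym (count-suc-at i agree pᵢ qᵢ))) (parity-suc (count p))
... | true  = begin
  parity (count q)              ≡⟨ sym (p⊕q⊕q≡p _ 1ℙ) ⟩
  parity (count q) ⊕ 1ℙ ⊕ 1ℙ    ≡⟨ cong (_⊕ 1ℙ) (sym (parity-suc (count q))) ⟩
  parity (suc (count q)) ⊕ 1ℙ   ≡⟨ cong (λ m → parity m ⊕ 1ℙ)
                                      (count-suc-at i (λ j j≢i → sym (agree j j≢i)) qᵢ pᵢ) ⟩
  parity (count p) ⊕ 1ℙ         ∎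
  where open ≡-Reasoning

Undirected : EdgeRel n → Set
Undirected X = ∀ u v → X u v ≡ X v u

Edge : EdgeRel n → Fin n → Fin n → Set
Edge X u v = X u v ≡ true

SamePair : (a b u v : Fin n) → Set
SamePair a b u v = (u ≡ a × v ≡ b) ⊎ (u ≡ b × v ≡ a)

samePair? : (a b u v : Fin n) → Dec (SamePair a b u v)
samePair? a b u v = (u ≟ a ×-dec v ≟ b) ⊎-dec (u ≟ b ×-dec v ≟ a)

SamePair-flip : {a b u v : Fin n} → SamePair a b u v → SamePair a b v u
SamePair-flip = Sum.swap ∘ Sum.map swap swap

toggle : EdgeRel n → Fin n → Fin n → EdgeRel n
toggle X a b u v = does (samePair? a b u v) xor X u v

module _ (X : EdgeRel n) {a b u v : Fin n} where

  toggle-on : SamePair a b u v → toggle X a b u v ≡ not (X u v)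
  toggle-on s rewrite dec-true (samePair? a b u v) s = refl

  toggle-off : ¬ SamePair a b u v → toggle X a b u v ≡ X u v
  toggle-off ¬s rewrite dec-false (samePair? a b u v) ¬s = refl

toggle-undirected : {X : EdgeRel n} {a b : Fin n} → Undirected X → Undirected (toggle X a b)
toggle-undirected {X = X} {a} {b} X-undirected u v with samePair? a b u v
... | yes s = trans (toggle-on X s) (trans (cong not (X-undirected u v)) (sym (toggle-on X (SamePair-flip s))))
... | no ¬s = trans (toggle-off X ¬s) (trans (X-undirected u v) (sym (toggle-off X (¬s ∘ SamePair-flip))))

toggle-edgeSubset : {G : SimpleGraph n} {X : EdgeRel n} {a b : Fin n} →
  IsEdgeSubset G X → Adj G a b ≡ true → IsEdgeSubset G (toggle X a b)
toggle-edgeSubset {G = G} {X} {a} {b} (X-undirected , X⊆G) ab∈G = toggle-undirected X-undirected , ⊆G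
  where
  ⊆G : ∀ u v → toggle X a b u v ≡ true → Adj G u v ≡ true
  ⊆G u v uv∈X with samePair? a b u v
  ... | yes (inj₁ (refl , refl)) = ab∈G
  ... | yes (inj₂ (refl , refl)) = trans (SimpleGraph.sym G u v) ab∈G
  ... | no ¬s = X⊆G u v (trans (sym (toggle-off X ¬s)) uv∈X)

δ : Fin n → Fin n → Parity
δ a z = if does (a ≟ z) then 1ℙ else 0ℙ

SamePair-partner : {a b v : Fin n} → a ≢ b → SamePair a b a v → v ≡ b
SamePair-partner _   (inj₁ (_ , v≡b))  = v≡b
SamePair-partner a≢b (inj₂ (a≡b , _)) = contradiction a≡b a≢b

toggle-degree-parity-endpoint : (X : EdgeRel n) {a b z : Fin n} (c : Fin n) →
  (∀ {j} → SamePair a b z j → j ≡ c) → SamePair a b z c →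
  parity (degree (toggle X a b) z) ≡ parity (degree X z) ⊕ 1ℙ
toggle-degree-parity-endpoint X c only-c zc =
  count-parity-flip c (λ j j≢c → sym (toggle-off X (j≢c ∘ only-c))) (toggle-on X zc)

toggle-degree-parity : (X : EdgeRel n) {a b : Fin n} → a ≢ b → ∀ z →
  parity (degree (toggle X a b) z) ≡ parity (degree X z) ⊕ δ a z ⊕ δ b z
toggle-degree-parity X {a} {b} a≢b z with a ≟ z | b ≟ z
... | yes refl | yes refl = contradiction refl a≢b
... | yes refl | no _     =
  trans (toggle-degree-parity-endpoint X b (SamePair-partner a≢b) (inj₁ (refl , refl))) (sym (⊕-identityʳ _))
... | no _     | yes refl =
  trans (toggle-degree-parity-endpoint X a (SamePair-partner (≢-sym a≢b) ∘ Sum.swap) (inj₂ (refl , refl)))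
        (cong (_⊕ 1ℙ) (sym (⊕-identityʳ (parity (degree X b)))))
... | no a≢z   | no b≢z   =
  trans (cong parity (count-cong λ j →
           toggle-off X {v = j} (Sum.[ a≢z ∘ sym , b≢z ∘ sym ] ∘ Sum.map proj₁ proj₁)))
        (sym (trans (⊕-identityʳ _) (⊕-identityʳ _)))

-- For a < b, edgeCount sees the pair {a, b} only through the entry (a, b).
edgeCount-suc-< : {X Y : EdgeRel n} {a b : Fin n} → a Fin.< b →
  (∀ u v → ¬ SamePair a b u v → X u v ≡ Y u v) → X a b ≡ false → Y a b ≡ true →
  suc (edgeCount X) ≡ edgeCount Y
edgeCount-suc-< {X = X} {Y} {a} {b} a<b agree Xab Yab =
  sumFin-suc-at a (λ u u≢a → count-cong λ v → upper u v (inj₁ u≢a))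
    (count-suc-at b (λ v v≢b → upper a v (inj₂ v≢b))
      (cong₂ _∧_ a<ᵇb Xab) (cong₂ _∧_ a<ᵇb Yab))
  where
  a<ᵇb : does (a <? b) ≡ true
  a<ᵇb = dec-true (a <? b) a<b
  upper : ∀ u v → u ≢ a ⊎ v ≢ b → does (u <? v) ∧ X u v ≡ does (u <? v) ∧ Y u v
  upper u v off with samePair? a b u v
  ... | yes (inj₁ (refl , refl)) = contradiction off λ { (inj₁ u≢a) → u≢a refl ; (inj₂ v≢b) → v≢b refl }
  ... | yes (inj₂ (refl , refl)) rewrite dec-false (b <? a) (<-asym a<b) = refl
  ... | no ¬s = cong (does (u <? v) ∧_) (agree u v ¬s)

edgeCount-suc : {X Y : EdgeRel n} {a b : Fin n} → Undirected X → Undirected Y → a ≢ b →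
  (∀ u v → ¬ SamePair a b u v → X u v ≡ Y u v) → X a b ≡ false → Y a b ≡ true →
  suc (edgeCount X) ≡ edgeCount Y
edgeCount-suc {a = a} {b} X-undirected Y-undirected a≢b agree Xab Yab with <-cmp a b
... | tri< a<b _ _ = edgeCount-suc-< a<b agree Xab Yab
... | tri≈ _ a≡b _ = contradiction a≡b a≢b
... | tri> _ _ b<a = edgeCount-suc-< b<a (λ u v → agree u v ∘ (_∘ Sum.swap))
                       (trans (X-undirected b a) Xab) (trans (Y-undirected b a) Yab)

toggle-edgeCount-remove : {X : EdgeRel n} {a b : Fin n} → Undirected X → a ≢ b → X a b ≡ true →
  suc (edgeCount (toggle X a b)) ≡ edgeCount X
toggle-edgeCount-remove {X = X} X-undirected a≢b Xab =
  edgeCount-suc (toggle-undirected X-undirected) X-undirected a≢b (λ _ _ → toggle-off X)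
    (trans (toggle-on X (inj₁ (refl , refl))) (cong not Xab)) Xab

toggle-edgeCount-≤ : {X : EdgeRel n} {a b : Fin n} → Undirected X → a ≢ b →
  edgeCount (toggle X a b) ≤ suc (edgeCount X)
toggle-edgeCount-≤ {X = X} {a} {b} X-undirected a≢b with X a b in Xab
... | true  = m≤n⇒m≤1+n (<⇒≤ (≤-reflexive (toggle-edgeCount-remove X-undirected a≢b Xab)))
... | false = ≤-reflexive (sym (edgeCount-suc X-undirected (toggle-undirected X-undirected) a≢b
                 (λ _ _ → sym ∘ toggle-off X) Xab (trans (toggle-on X (inj₁ (refl , refl))) (cong not Xab))))

lastOf : {A : Set} → A → List A → A
lastOf x []       = x
lastOf x (y ∷ ys) = lastOf y ys

lastOf-∈ : {A : Set} (x : A) (xs : List A) → lastOf x xs ∈ x ∷ xs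
lastOf-∈ x []       = here refl
lastOf-∈ x (y ∷ ys) = there (lastOf-∈ y ys)

togglePath : EdgeRel n → Fin n → List (Fin n) → EdgeRel n
togglePath X x []       = X
togglePath X x (y ∷ ys) = togglePath (toggle X x y) y ys

togglePath-degree-parity : (X : EdgeRel n) {x : Fin n} {ys : List (Fin n)} → Unique (x ∷ ys) → ∀ z →
  parity (degree (togglePath X x ys) z) ≡ parity (degree X z) ⊕ δ x z ⊕ δ (lastOf x ys) z
togglePath-degree-parity X {x} {[]} _ z = sym (p⊕q⊕q≡p _ (δ x z))
togglePath-degree-parity X {x} {y ∷ ys} ((x≢y ∷ _) ∷ unique) z = begin
  parity (degree (togglePath (toggle X x y) y ys) z)  ≡⟨ togglePath-degree-parity (toggle X x y) unique z ⟩
  parity (degree (toggle X x y) z) ⊕ δ y z ⊕ δ l z    ≡⟨ cong (λ p → p ⊕ δ y z ⊕ δ l z) (toggle-degree-parity X x≢y z) ⟩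
  parity (degree X z) ⊕ δ x z ⊕ δ y z ⊕ δ y z ⊕ δ l z ≡⟨ cong (_⊕ δ l z) (p⊕q⊕q≡p (parity (degree X z) ⊕ δ x z) (δ y z)) ⟩
  parity (degree X z) ⊕ δ x z ⊕ δ l z                 ∎
  where
  open ≡-Reasoning
  l = lastOf y ys

Linked-toggle : {X : EdgeRel n} {x y : Fin n} {zs : List (Fin n)} →
  All (x ≢_) zs → Linked (Edge X) zs → Linked (Edge (toggle X x y)) zs
Linked-toggle _                []            = []
Linked-toggle _                [-]           = [-]
Linked-toggle {X = X} (x≢u ∷ x≢v ∷ x≢zs) (uv∈X ∷ edges) =
  trans (toggle-off X λ { (inj₁ (u≡x , _)) → x≢u (sym u≡x) ; (inj₂ (_ , v≡x)) → x≢v (sym v≡x) }) uv∈X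
    ∷ Linked-toggle (x≢v ∷ x≢zs) edges

togglePath-edgeSubset : {G : SimpleGraph n} {X : EdgeRel n} {x : Fin n} {ys : List (Fin n)} →
  IsEdgeSubset G X → Unique (x ∷ ys) → Linked (Edge X) (x ∷ ys) → IsEdgeSubset G (togglePath X x ys)
togglePath-edgeSubset sub _ [-] = sub
togglePath-edgeSubset {G = G} {X} {x} {y ∷ _} sub (x≢ys ∷ unique) (xy∈X ∷ edges) =
  togglePath-edgeSubset {G = G} {toggle X x y} {y} (toggle-edgeSubset {G = G} sub (proj₂ sub _ _ xy∈X))
    unique (Linked-toggle x≢ys edges)

togglePath-edgeCount : {X : EdgeRel n} {x : Fin n} {ys : List (Fin n)} →
  Undirected X → Unique (x ∷ ys) → Linked (Edge X) (x ∷ ys) →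
  edgeCount (togglePath X x ys) + length ys ≡ edgeCount X
togglePath-edgeCount X-undirected _ [-] = +-identityʳ _
togglePath-edgeCount {X = X} {x} {y ∷ ys} X-undirected (x≢ys@(x≢y ∷ _) ∷ unique) (xy∈X ∷ edges) = begin
  edgeCount (togglePath T y ys) + suc (length ys)  ≡⟨ +-suc _ (length ys) ⟩
  suc (edgeCount (togglePath T y ys) + length ys)  ≡⟨ cong suc (togglePath-edgeCount T-undirected unique T-edges) ⟩
  suc (edgeCount T)                                ≡⟨ toggle-edgeCount-remove X-undirected x≢y xy∈X ⟩
  edgeCount X                                      ∎
  where
  open ≡-Reasoning
  T = toggle X x y
  T-undirected : Undirected T
  T-undirected = toggle-undirected X-undirected
  T-edges : Linked (Edge T) (y ∷ ys)
  T-edges = Linked-toggle x≢ys edges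

record Path (X : EdgeRel n) (u v : Fin n) : Set where
  constructor path
  field
    rest     : List (Fin n)
    distinct : Unique (u ∷ rest)
    edges    : Linked (Edge X) (u ∷ rest)
    ends     : lastOf u rest ≡ v

shortcut : {G : SimpleGraph n} {S : EdgeRel n} {u v : Fin n} → IsSolution G S →
  (p : Path S u v) → 2 ≤ length (Path.rest p) → Adj G v u ≡ true →
  Σ[ X ∈ EdgeRel n ] IsSolution G X × edgeCount X < edgeCount S
shortcut {G = G} {S} {u} (S⊆G , S-odd) (path ws@(y ∷ _) distinct@(u≢ws ∷ _) edges refl) 2≤|ws| vu∈G =
  X , (toggle-edgeSubset {G = G} T⊆G vu∈G , X-odd) , X<S
  where
  v = lastOf u ws
  v≢u : v ≢ u
  v≢u = ≢-sym (All.lookup u≢ws (lastOf-∈ y _))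
  T = togglePath S u ws
  T⊆G : IsEdgeSubset G T
  T⊆G = togglePath-edgeSubset {G = G} S⊆G distinct edges
  X = toggle T v u
  X-odd : ∀ z → degree X z % 2 ≡ 1
  X-odd z = parity≡1ℙ⇒%2≡1 (degree X z) (begin
    parity (degree X z)                                   ≡⟨ toggle-degree-parity T v≢u z ⟩
    parity (degree T z) ⊕ δ v z ⊕ δ u z                   ≡⟨ cong (λ p → p ⊕ δ v z ⊕ δ u z)
                                                               (togglePath-degree-parity S distinct z) ⟩
    parity (degree S z) ⊕ δ u z ⊕ δ v z ⊕ δ v z ⊕ δ u z   ≡⟨ cong (_⊕ δ u z) (p⊕q⊕q≡p (parity (degree S z) ⊕ δ u z) (δ v z)) ⟩
    parity (degree S z) ⊕ δ u z ⊕ δ u z                   ≡⟨ p⊕q⊕q≡p (parity (degree S z)) (δ u z) ⟩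
    parity (degree S z)                                   ≡⟨ %2≡1⇒parity≡1ℙ (degree S z) (S-odd z) ⟩
    1ℙ                                                    ∎)
    where open ≡-Reasoning
  X<S : edgeCount X < edgeCount S
  X<S = begin-strict
    edgeCount X                 ≤⟨ toggle-edgeCount-≤ (proj₁ T⊆G) v≢u ⟩
    suc (edgeCount T)           <⟨ n<1+n _ ⟩
    2 + edgeCount T             ≡⟨ +-comm 2 (edgeCount T) ⟩
    edgeCount T + 2             ≤⟨ +-monoʳ-≤ (edgeCount T) 2≤|ws| ⟩
    edgeCount T + length ws     ≡⟨ togglePath-edgeCount (proj₁ S⊆G) distinct edges ⟩
    edgeCount S                 ∎
    where open ≤-Reasoning

Path-from : {X : EdgeRel n} {x u v : Fin n} (p : Path X x v) → u ∈ x ∷ Path.rest p → Path X u v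
Path-from p (here refl) = p
Path-from (path (_ ∷ ys) (_ ∷ distinct) (_ ∷ edges) ends) (there u∈ys) =
  Path-from (path ys distinct edges ends) u∈ys

Path-cons : {X : EdgeRel n} {u x v : Fin n} → Edge X u x → Path X x v → Path X u v
Path-cons {u = u} {x} ux∈X p@(path ys distinct edges ends) with DecMembership._∈?_ _≟_ u (x ∷ ys)
... | yes u∈p = Path-from p u∈p
... | no  u∉p = path (x ∷ ys) (¬Any⇒All¬ _ u∉p ∷ distinct) (ux∈X ∷ edges) ends

walk⇒path : {X : EdgeRel n} {P : Fin n → Set} {u v : Fin n} → Walk X P u v → Path X u v
walk⇒path (here _)       = path [] ([] ∷ []) [-] refl
walk⇒path (step _ ux∈X w) = Path-cons ux∈X (walk⇒path w)

module _ {X : EdgeRel n} {P : Fin n → Set} where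

  Walk-snoc : {a b c : Fin n} → Walk X P a b → P c → Edge X b c → Walk X P a c
  Walk-snoc (here Pa)        Pc bc∈X = step Pa bc∈X (here Pc)
  Walk-snoc (step Pa ab∈X w) Pc bc∈X = step Pa ab∈X (Walk-snoc w Pc bc∈X)

  Walk-reverse : Undirected X → {a b : Fin n} → Walk X P a b → Walk X P b a
  Walk-reverse _            (here Pa)        = here Pa
  Walk-reverse X-undirected (step Pa ab∈X w) =
    Walk-snoc (Walk-reverse X-undirected w) Pa (trans (X-undirected _ _) ab∈X)

  Walk-++ : {a b c : Fin n} → Walk X P a b → Walk X P b c → Walk X P a c
  Walk-++ (here _)         w′ = w′
  Walk-++ (step Pa ab∈X w) w′ = step Pa ab∈X (Walk-++ w w′)

Linked-∷ʳ⁻ : {A : Set} {R : A → A → Set} {x y : A} (xs : List A) →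
  Linked R (x ∷ xs ++ [ y ]) → Linked R (x ∷ xs) × R (lastOf x xs) y
Linked-∷ʳ⁻ []       (xy ∷ [-]) = [-] , xy
Linked-∷ʳ⁻ (_ ∷ xs) (xz ∷ zs)  = Product.map₁ (xz ∷_) (Linked-∷ʳ⁻ xs zs)

Linked-restrict : {A : Set} {P : A → Set} {R S : A → A → Set} →
  (∀ {x y} → P x → P y → R x y → S x y) → {xs : List A} → All P xs → Linked R xs → Linked S xs
Linked-restrict R⇒S _              []         = []
Linked-restrict R⇒S _              [-]        = [-]
Linked-restrict R⇒S (Px ∷ Py ∷ Pxs) (xy ∷ ys) = R⇒S Px Py xy ∷ Linked-restrict R⇒S (Py ∷ Pxs) ys

module _ {G : SimpleGraph n} {S : EdgeRel n} (S-optimal : IsOptimalSolution G S) where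

  private
    S-solution = proj₁ S-optimal
    S-undirected = proj₁ (proj₁ S-solution)
    S⊆G = proj₂ (proj₁ S-solution)

  optimal-no-shortcut : {u v : Fin n} (p : Path S u v) → 2 ≤ length (Path.rest p) → ¬ Adj G v u ≡ true
  optimal-no-shortcut p 2≤|p| vu∈G with shortcut {G = G} S-solution p 2≤|p| vu∈G
  ... | X , X-solution , X<S = <⇒≱ X<S (proj₂ S-optimal X X-solution)

  optimal-acyclic : ¬ Cycle S (λ _ → ⊤)
  optimal-acyclic (v , ws , s≤s 2≤|ws| , distinct , _ , closed) with Linked-∷ʳ⁻ ws closed
  ... | edges , lv∈S = optimal-no-shortcut (path ws distinct edges refl) 2≤|ws| (S⊆G _ _ lv∈S)

  optimal-walk-adjacent : {P : Fin n → Set} {u v : Fin n} → Walk S P u v → Adj G u v ≡ true → S u v ≡ true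
  optimal-walk-adjacent {u = u} w uv∈G with walk⇒path w
  ... | path [] _ _ refl = contradiction (trans (sym uv∈G) (irrefl G u)) λ ()
  ... | path (_ ∷ []) _ (uv∈S ∷ [-]) refl = uv∈S
  ... | p@(path (_ ∷ _ ∷ _) _ _ refl) =
    contradiction (trans (SimpleGraph.sym G _ u) uv∈G) (optimal-no-shortcut p (s≤s (s≤s z≤n)))

  optimal-walk-induced : {P : Fin n → Set} {u v : Fin n} → Walk S P u v → Adj G u v ≡ S u v
  optimal-walk-induced w = ⇔→≡ {z = true} (mk⇔ (optimal-walk-adjacent w) (S⊆G _ _))

  module _ (w : Fin n) where

    private
      C = Component S w

    component-walk : {u v : Fin n} → C u → C v → Walk S (λ _ → ⊤) u v
    component-walk w⇝u w⇝v = Walk-++ (Walk-reverse S-undirected w⇝u) w⇝v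

    component-induced : {u v : Fin n} → C u → C v → Adj G u v ≡ S u v
    component-induced w⇝u w⇝v = optimal-walk-induced (component-walk w⇝u w⇝v)

    walk-within-component : {u v : Fin n} → Walk S (λ _ → ⊤) u v → C u → Walk (Adj G) C u v
    walk-within-component (here _)        w⇝u = here w⇝u
    walk-within-component (step _ ux∈S p) w⇝u =
      step w⇝u (S⊆G _ _ ux∈S) (walk-within-component p (Walk-snoc w⇝u tt ux∈S))

    component-isTree : IsTree (Adj G) C
    component-isTree = (w , here tt) , connected , acyclic
      where
      connected : Connected (Adj G) C
      connected u v w⇝u w⇝v = walk-within-component (component-walk w⇝u w⇝v) w⇝u
      acyclic : ¬ Cycle (Adj G) C
      acyclic (v , ws , 3≤ , distinct , inC@(w⇝v ∷ _) , closed) =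
        optimal-acyclic (v , ws , 3≤ , distinct , All.universal (λ _ → tt) _ ,
          Linked-restrict (λ w⇝x w⇝y xy∈G → trans (sym (component-induced w⇝x w⇝y)) xy∈G)
            (∷ʳ⁺ inC w⇝v) closed)

theorem3p5 : (n : ℕ) (G : SimpleGraph n) → HasSolution G →
    (S : EdgeRel n) → IsOptimalSolution G S →
    ¬ Cycle S (λ _ → ⊤) ×
    ((w : Fin n) →
      IsTree (Adj G) (Component S w) ×
      ((u v : Fin n) → Component S w u → Component S w v → Adj G u v ≡ S u v))
theorem3p5 n G _ S S-optimal =
  optimal-acyclic {G = G} S-optimal ,
  λ w → component-isTree {G = G} S-optimal w , λ u v → component-induced {G = G} S-optimal w
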